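{- Suppose that every strongly admissible multiset of the form $\{1^a,x^b,y^c\}$ with integers $1<x<y$, $a,b,c\ge1$, and $a\ge\max(b,c)$ is realizable. Then every strongly admissible multiset $L$ with $|\mathrm{supp}(L)|=3$ is realizable.
   Context: $K_v$ is the complete graph on vertex set $\{0,\dots,v-1\}$; the length of an edge $\{u,w\}$ is $\min(|u-w|,v-|u-w|)$. A multiset $L$ of size $v-1$ is realizable if some Hamiltonian path in $K_v$ has multiset of edge lengths equal to $L$. $\{x_1^{a_1},\dots\}$ denotes the multiset with $x_i$ of multiplicity $a_i$; $\mathrm{supp}(L)$ is the set of distinct elements. $L$ of size $v-1$ is strongly admissible if $\mathrm{supp}(L)\subseteq\{1,\dots,\lfloor v/2\rfloor\}$ and $\gcd(v,z)=1$ for every $z\in L$. -}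

module Defs where

open import Data.Nat using (ℕ; suc; _∸_; _⊓_; _≤_; _/_; ∣_-_∣)
open import Data.Nat.Properties using (_≟_)
open import Data.Nat.Coprimality using (Coprime)
open import Data.List using (List; []; _∷_; length; upTo; deduplicate; zipWith; replicate; _++_)
open import Data.List.Relation.Unary.All using (All)
open import Data.List.Relation.Binary.Permutation.Propositional using (_↭_)
open import Data.Product using (_×_; ∃-syntax)
open import Relation.Binary.PropositionalEquality using (_≡_)

-- Multisets of naturals are represented by lists, compared up to permutation (_↭_).

edgeLen : ℕ → ℕ → ℕ → ℕ
edgeLen v u w = ∣ u - w ∣ ⊓ (v ∸ ∣ u - w ∣)

pathLengths : ℕ → List ℕ → List ℕ
pathLengths v [] = []
pathLengths v (u ∷ []) = []
pathLengths v (u ∷ w ∷ ps) = edgeLen v u w ∷ pathLengths v (w ∷ ps)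

HamPath : ℕ → List ℕ → Set
HamPath v p = p ↭ upTo v

Realizable : ℕ → List ℕ → Set
Realizable v L = ∃[ p ] (HamPath v p × pathLengths v p ↭ L)

supp : List ℕ → List ℕ
supp = deduplicate _≟_

StronglyAdmissible : ℕ → List ℕ → Set
StronglyAdmissible v L =
  length L ≡ v ∸ 1
  × All (λ z → 1 ≤ z × z ≤ v / 2) L
  × All (λ z → Coprime v z) L

ms3 : ℕ → ℕ → ℕ → ℕ → ℕ → List ℕ
ms3 a x b y c = replicate a 1 ++ replicate b x ++ replicate c y

-- Let m be the most frequent length of L and u an inverse of m modulo v, which exists since
-- gcd(v, m) = 1.  The map i ↦ u·i mod v permutes the vertices of K_v and turns an edge of length
-- l into one of length ‖u·l‖, the residue of u·l taken up to sign in [0, v/2]; multiplication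
-- by m undoes this on lengths at most v/2.  So rescaling by u turns L = {m^a, e^b, f^c} into the
-- strongly admissible {1^a, x^b, y^c} with a ≥ max(b, c), realizable by hypothesis, and
-- rescaling that realization by m realizes L.

module Submission where

open import Data.Integer as ℤ using (ℤ; +_; 0ℤ; 1ℤ; _+_; _-_; -_; _*_; _⊖_)
open import Data.Integer.DivMod using (_%ℕ_; _/ℕ_; n%ℕd<d; a≡a%ℕn+[a/ℕn]*n)
open import Data.Integer.Divisibility.Signed
  using (_∣_; divides; ∣⇒∣ᵤ; ∣ᵤ⇒∣; ∣-trans; ∣m⇒∣-m; ∣m∣n⇒∣m+n; ∣m∣n⇒∣m-n; ∣n⇒∣m*n)
open import Data.Integer.Properties as ℤ using ()
open import Data.Integer.Tactic.RingSolver using (solve-∀)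
open import Data.List using (List; []; _∷_; map; upTo; applyUpTo; length; replicate; _++_)
open import Data.List.Membership.Propositional using (_∈_)
open import Data.List.Membership.Propositional.Properties
  using (∈-deduplicate⁺; ∈-deduplicate⁻; ∈-++⁺ˡ; ∈-++⁺ʳ; ∈-applyUpTo⁺; ∈-applyUpTo⁻; ∈-upTo⁺; ∈-upTo⁻)
open import Data.List.Membership.Propositional.Properties.WithK using (unique∧set⇒bag)
open import Data.List.Properties
  using (map-upTo; length-map; map-++; map-replicate; ++-assoc; map-∘; map-id-local)
open import Data.List.Relation.Binary.BagAndSetEquality using (∼bag⇒↭)
open import Data.List.Relation.Binary.Permutation.Propositional
  using (_↭_; ↭-refl; ↭-sym; ↭-trans; ↭-reflexive; prep)
open import Data.List.Relation.Binary.Permutation.Propositional.Properties as ↭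
  using (All-resp-↭; ∈-resp-↭; ++⁺ˡ; shift; ++-comm; ↭-length)
open import Data.List.Relation.Unary.All as All using (All; []; _∷_)
open import Data.List.Relation.Unary.All.Properties as All using (All¬⇒¬Any)
open import Data.List.Relation.Unary.AllPairs using ([]; _∷_)
open import Data.List.Relation.Unary.Any using (here; there)
open import Data.List.Relation.Unary.Unique.Propositional using (Unique)
open import Data.List.Relation.Unary.Unique.Propositional.Properties using (applyUpTo⁺₁; upTo⁺)
open import Data.Nat as ℕ using (ℕ; zero; suc; _≤_; _<_; _⊔_; z≤n; s≤s; NonZero; _⊓_; _∸_; _/_)
open import Data.Nat.Coprimality using (Coprime; coprime-Bézout)
open import Data.Nat.DivMod using (m/n*n≤m; m*n/n≡m; /-monoˡ-≤; m/n<m)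
open import Data.Nat.Divisibility as ℕ using (>⇒∤)
open import Data.Nat.GCD using (module Bézout)
open import Data.Nat.Properties as ℕ using (_≟_)
open import Data.List.Relation.Unary.Unique.DecPropositional.Properties _≟_ using (deduplicate-!)
open import Data.Product using (_×_; _,_; proj₁; proj₂; ∃-syntax)
open import Data.Sum using (_⊎_; inj₁; inj₂)
open import Function.Bundles using (mk⇔)
open import Level using (0ℓ)
open import Relation.Binary.Bundles using (Setoid)
open import Relation.Binary.Definitions using (tri<; tri≈; tri>)
open import Relation.Binary.PropositionalEquality
import Relation.Binary.Reasoning.Setoid as SetoidReasoning
open import Relation.Nullary using (contradiction)

open import Defs using (edgeLen; pathLengths; Realizable; StronglyAdmissible; supp; ms3)

private
  variable
    a b d l l′ : ℕ
    L : List ℕ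

m≤o/2⇒n≤o/2⇒m+n≤o : ∀ {m n o} → m ≤ o / 2 → n ≤ o / 2 → m ℕ.+ n ≤ o
m≤o/2⇒n≤o/2⇒m+n≤o {m} {n} {o} m≤o/2 n≤o/2 = begin
  m ℕ.+ n             ≤⟨ ℕ.+-mono-≤ m≤o/2 n≤o/2 ⟩
  o / 2 ℕ.+ o / 2     ≡⟨ cong (o / 2 ℕ.+_) (sym (ℕ.+-identityʳ (o / 2))) ⟩
  2 ℕ.* (o / 2)       ≡⟨ ℕ.*-comm 2 (o / 2) ⟩
  o / 2 ℕ.* 2         ≤⟨ m/n*n≤m o 2 ⟩
  o                   ∎
  where open ℕ.≤-Reasoning

m+m≤n⇒m≤n/2 : ∀ {m n} → m ℕ.+ m ≤ n → m ≤ n / 2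
m+m≤n⇒m≤n/2 {m} {n} m+m≤n = begin
  m                   ≡⟨ m*n/n≡m m 2 ⟨
  m ℕ.* 2 / 2         ≤⟨ /-monoˡ-≤ 2 m*2≤n ⟩
  n / 2               ∎
  where
    open ℕ.≤-Reasoning
    m*2≤n : m ℕ.* 2 ≤ n
    m*2≤n = begin
      m ℕ.* 2         ≡⟨ ℕ.*-comm m 2 ⟩
      m ℕ.+ (m ℕ.+ 0) ≡⟨ cong (m ℕ.+_) (ℕ.+-identityʳ m) ⟩
      m ℕ.+ m         ≤⟨ m+m≤n ⟩
      n               ∎

∣+m-+n∣≡∣m-n∣ : ∀ m n → ℤ.∣ + m - + n ∣ ≡ ℕ.∣ m - n ∣
∣+m-+n∣≡∣m-n∣ m n with ℕ.≤-total m n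
... | inj₁ m≤n = begin
  ℤ.∣ + m - + n ∣  ≡⟨ cong ℤ.∣_∣ (ℤ.m-n≡m⊖n m n) ⟩
  ℤ.∣ m ⊖ n ∣      ≡⟨ ℤ.∣⊖∣-≤ m≤n ⟩
  n ∸ m            ≡⟨ ℕ.m≤n⇒∣m-n∣≡n∸m m≤n ⟨
  ℕ.∣ m - n ∣      ∎
  where open ≡-Reasoning
... | inj₂ n≤m = begin
  ℤ.∣ + m - + n ∣  ≡⟨ cong ℤ.∣_∣ (ℤ.m-n≡m⊖n m n) ⟩
  ℤ.∣ m ⊖ n ∣      ≡⟨ ℤ.∣m⊖n∣≡∣n⊖m∣ m n ⟩
  ℤ.∣ n ⊖ m ∣      ≡⟨ ℤ.∣⊖∣-≤ n≤m ⟩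
  m ∸ n            ≡⟨ ℕ.m≤n⇒∣m-n∣≡n∸m n≤m ⟨
  ℕ.∣ n - m ∣      ≡⟨ ℕ.∣-∣-comm n m ⟩
  ℕ.∣ m - n ∣      ∎
  where open ≡-Reasoning

map-upTo-↭ : ∀ {n} {f g : ℕ → ℕ} →
             (∀ {i} → i < n → f i < n) → (∀ {i} → i < n → g i < n) →
             (∀ {i} → i < n → g (f i) ≡ i) → (∀ {i} → i < n → f (g i) ≡ i) →
             map f (upTo n) ↭ upTo n
map-upTo-↭ {n} {f} {g} f< g< g∘f≗id f∘g≗id =
  subst (_↭ upTo n) (sym (map-upTo f n))
    (∼bag⇒↭ (unique∧set⇒bag (applyUpTo⁺₁ f n f-injective) (upTo⁺ n) (mk⇔ image⊆ image⊇)))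
  where
    f-injective : ∀ {i j} → i < j → j < n → f i ≢ f j
    f-injective {i} {j} i<j j<n fi≡fj = ℕ.<⇒≢ i<j (begin
      i          ≡⟨ g∘f≗id (ℕ.<-trans i<j j<n) ⟨
      g (f i)    ≡⟨ cong g fi≡fj ⟩
      g (f j)    ≡⟨ g∘f≗id j<n ⟩
      j          ∎)
      where open ≡-Reasoning
    image⊆ : ∀ {z} → z ∈ applyUpTo f n → z ∈ upTo n
    image⊆ z∈ with i , i<n , refl ← ∈-applyUpTo⁻ f z∈ = ∈-upTo⁺ (f< i<n)
    image⊇ : ∀ {z} → z ∈ upTo n → z ∈ applyUpTo f n
    image⊇ z∈ = subst (_∈ applyUpTo f n) (f∘g≗id (∈-upTo⁻ z∈)) (∈-applyUpTo⁺ f (g< (∈-upTo⁻ z∈)))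

1+a*b≡c*d⇒ℤ : ∀ a b c d → 1 ℕ.+ a ℕ.* b ≡ c ℕ.* d → 1ℤ + + a * + b ≡ + c * + d
1+a*b≡c*d⇒ℤ a b c d eq = begin
  1ℤ + + a * + b     ≡⟨ cong (_+_ 1ℤ) (ℤ.pos-* a b) ⟨
  + (1 ℕ.+ a ℕ.* b)  ≡⟨ cong +_ eq ⟩
  + (c ℕ.* d)        ≡⟨ ℤ.pos-* c d ⟩
  + c * + d          ∎
  where open ≡-Reasoning

module Modulo (v : ℕ) .{{_ : NonZero v}} where

  infix 4 _≡ᵥ_ _≡±_ _IsInverseOf_

  record _≡ᵥ_ (i j : ℤ) : Set where
    constructor mk≡ᵥ
    field v∣i-j : + v ∣ i - j

  private
    variable
      i i′ j j′ k : ℤ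

    v∣0 : + v ∣ 0ℤ
    v∣0 = divides 0ℤ refl

  ≡ᵥ-refl : i ≡ᵥ i
  ≡ᵥ-refl {i} = mk≡ᵥ (subst (+ v ∣_) (sym (ℤ.+-inverseʳ i)) v∣0)

  ≡ᵥ-reflexive : i ≡ j → i ≡ᵥ j
  ≡ᵥ-reflexive refl = ≡ᵥ-refl

  ≡ᵥ-sym : i ≡ᵥ j → j ≡ᵥ i
  ≡ᵥ-sym {i} {j} (mk≡ᵥ v∣i-j) = mk≡ᵥ (subst (+ v ∣_) (identity i j) (∣m⇒∣-m v∣i-j))
    where identity : ∀ i j → - (i - j) ≡ j - i
          identity = solve-∀

  ≡ᵥ-trans : i ≡ᵥ j → j ≡ᵥ k → i ≡ᵥ k
  ≡ᵥ-trans {i} {j} {k} (mk≡ᵥ v∣i-j) (mk≡ᵥ v∣j-k) =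
    mk≡ᵥ (subst (+ v ∣_) (identity i j k) (∣m∣n⇒∣m+n v∣i-j v∣j-k))
    where identity : ∀ i j k → (i - j) + (j - k) ≡ i - k
          identity = solve-∀

  ≡ᵥ-setoid : Setoid 0ℓ 0ℓ
  ≡ᵥ-setoid = record
    { Carrier = ℤ ; _≈_ = _≡ᵥ_
    ; isEquivalence = record { refl = ≡ᵥ-refl ; sym = ≡ᵥ-sym ; trans = ≡ᵥ-trans } }

  module ≡ᵥ-Reasoning = SetoidReasoning ≡ᵥ-setoid

  -‿cong : i ≡ᵥ j → - i ≡ᵥ - j
  -‿cong {i} {j} (mk≡ᵥ v∣i-j) = mk≡ᵥ (subst (+ v ∣_) (identity i j) (∣m⇒∣-m v∣i-j))
    where identity : ∀ i j → - (i - j) ≡ - i - - j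
          identity = solve-∀

  -‐cong : i ≡ᵥ i′ → j ≡ᵥ j′ → i - j ≡ᵥ i′ - j′
  -‐cong {i} {i′} {j} {j′} (mk≡ᵥ v∣i-i′) (mk≡ᵥ v∣j-j′) =
    mk≡ᵥ (subst (+ v ∣_) (identity i i′ j j′) (∣m∣n⇒∣m-n v∣i-i′ v∣j-j′))
    where identity : ∀ i i′ j j′ → (i - i′) - (j - j′) ≡ (i - j) - (i′ - j′)
          identity = solve-∀

  *-congˡ : ∀ k → i ≡ᵥ j → k * i ≡ᵥ k * j
  *-congˡ {i} {j} k (mk≡ᵥ v∣i-j) = mk≡ᵥ (subst (+ v ∣_) (identity k i j) (∣n⇒∣m*n k v∣i-j))
    where identity : ∀ k i j → k * (i - j) ≡ k * i - k * j
          identity = solve-∀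

  v≡ᵥ0 : + v ≡ᵥ 0ℤ
  v≡ᵥ0 = mk≡ᵥ (divides 1ℤ (trans (ℤ.+-identityʳ (+ v)) (sym (ℤ.*-identityˡ (+ v)))))

  %ℕ-≡ᵥ : ∀ i → + (i %ℕ v) ≡ᵥ i
  %ℕ-≡ᵥ i = mk≡ᵥ (divides (- (i /ℕ v)) (begin
    + (i %ℕ v) - i                            ≡⟨ cong (_-_ (+ (i %ℕ v))) (a≡a%ℕn+[a/ℕn]*n i v) ⟩
    + (i %ℕ v) - (+ (i %ℕ v) + i /ℕ v * + v)  ≡⟨ identity (+ (i %ℕ v)) (i /ℕ v) (+ v) ⟩
    - (i /ℕ v) * + v                          ∎))
    where open ≡-Reasoning
          identity : ∀ r q w → r - (r + q * w) ≡ - q * w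
          identity = solve-∀

  ∣⇒≡0 : v ℕ.∣ d → d < v → d ≡ 0
  ∣⇒≡0 {zero}  _   _   = refl
  ∣⇒≡0 {suc d} v∣d d<v = contradiction v∣d (>⇒∤ d<v)

  ≡ᵥ⇒≡ : a < v → b < v → + a ≡ᵥ + b → a ≡ b
  ≡ᵥ⇒≡ {a} {b} a<v b<v (mk≡ᵥ v∣a-b) = ℕ.∣m-n∣≡0⇒m≡n (∣⇒≡0 v∣∣a-b∣ ∣a-b∣<v)
    where
      v∣∣a-b∣ : v ℕ.∣ ℕ.∣ a - b ∣
      v∣∣a-b∣ = subst (v ℕ.∣_) (∣+m-+n∣≡∣m-n∣ a b) (∣⇒∣ᵤ v∣a-b)
      ∣a-b∣<v : ℕ.∣ a - b ∣ < v
      ∣a-b∣<v = ℕ.≤-trans (s≤s (ℕ.∣m-n∣≤m⊔n a b)) (ℕ.⊔-lub a<v b<v)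

  ≤v/2⇒<v : l ≤ v / 2 → l < v
  ≤v/2⇒<v l≤v/2 = ℕ.≤-<-trans l≤v/2 (m/n<m v 2 (s≤s (s≤s z≤n)))

  _≡±_ : ℤ → ℤ → Set
  i ≡± j = i ≡ᵥ j ⊎ i ≡ᵥ - j

  ≡ᵥ-neg-swap : i ≡ᵥ - j → j ≡ᵥ - i
  ≡ᵥ-neg-swap {i} {j} i≡-j = ≡ᵥ-sym (≡ᵥ-trans (-‿cong i≡-j) (≡ᵥ-reflexive (ℤ.neg-involutive j)))

  ≡±-sym : i ≡± j → j ≡± i
  ≡±-sym (inj₁ i≡j)  = inj₁ (≡ᵥ-sym i≡j)
  ≡±-sym (inj₂ i≡-j) = inj₂ (≡ᵥ-neg-swap i≡-j)

  ≡±-trans : i ≡± j → j ≡± k → i ≡± k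
  ≡±-trans (inj₁ i≡j)  (inj₁ j≡k)  = inj₁ (≡ᵥ-trans i≡j j≡k)
  ≡±-trans (inj₁ i≡j)  (inj₂ j≡-k) = inj₂ (≡ᵥ-trans i≡j j≡-k)
  ≡±-trans (inj₂ i≡-j) (inj₁ j≡k)  = inj₂ (≡ᵥ-trans i≡-j (-‿cong j≡k))
  ≡±-trans {k = k} (inj₂ i≡-j) (inj₂ j≡-k) =
    inj₁ (≡ᵥ-trans i≡-j (≡ᵥ-trans (-‿cong j≡-k) (≡ᵥ-reflexive (ℤ.neg-involutive k))))

  *-congˡ-≡± : ∀ k → i ≡± j → k * i ≡± k * j
  *-congˡ-≡± k (inj₁ i≡j)  = inj₁ (*-congˡ k i≡j)
  *-congˡ-≡± {j = j} k (inj₂ i≡-j) =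
    inj₂ (≡ᵥ-trans (*-congˡ k i≡-j) (≡ᵥ-reflexive (sym (ℤ.neg-distribʳ-* k j))))

  +∣i∣≡±i : ∀ i → + ℤ.∣ i ∣ ≡± i
  +∣i∣≡±i i with ℤ.+∣i∣≡i⊎+∣i∣≡-i i
  ... | inj₁ ∣i∣≡i  = inj₁ (≡ᵥ-reflexive ∣i∣≡i)
  ... | inj₂ ∣i∣≡-i = inj₂ (≡ᵥ-reflexive ∣i∣≡-i)

  ≡ᵥ-neg⇒∣+ : + l ≡ᵥ - + l′ → v ℕ.∣ l ℕ.+ l′
  ≡ᵥ-neg⇒∣+ {l} {l′} (mk≡ᵥ v∣l-[-l′]) = ∣⇒∣ᵤ (subst (+ v ∣_) l-[-l′]≡l+l′ v∣l-[-l′])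
    where
      l-[-l′]≡l+l′ : + l - - + l′ ≡ + (l ℕ.+ l′)
      l-[-l′]≡l+l′ = trans (cong (_+_ (+ l)) (ℤ.neg-involutive (+ l′))) (sym (ℤ.pos-+ l l′))

  ∣∧≤⇒≡0⊎≡v : v ℕ.∣ d → d ≤ v → d ≡ 0 ⊎ d ≡ v
  ∣∧≤⇒≡0⊎≡v v∣d d≤v with ℕ.m≤n⇒m<n∨m≡n d≤v
  ... | inj₁ d<v = inj₁ (∣⇒≡0 v∣d d<v)
  ... | inj₂ d≡v = inj₂ d≡v

  ≡±⇒≡ : l ≤ v / 2 → l′ ≤ v / 2 → + l ≡± + l′ → l ≡ l′
  ≡±⇒≡ l≤v/2 l′≤v/2 (inj₁ l≡l′) = ≡ᵥ⇒≡ (≤v/2⇒<v l≤v/2) (≤v/2⇒<v l′≤v/2) l≡l′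
  ≡±⇒≡ {l} {l′} l≤v/2 l′≤v/2 (inj₂ l≡-l′)
    with ∣∧≤⇒≡0⊎≡v (≡ᵥ-neg⇒∣+ l≡-l′) (m≤o/2⇒n≤o/2⇒m+n≤o l≤v/2 l′≤v/2)
  ... | inj₁ l+l′≡0 = trans (ℕ.m+n≡0⇒m≡0 l l+l′≡0) (sym (ℕ.m+n≡0⇒n≡0 l l+l′≡0))
  ... | inj₂ l+l′≡v = ℕ.≤-antisym
    (ℕ.+-cancelˡ-≤ l l l′ (m+m≤l+l′ l≤v/2))
    (ℕ.+-cancelˡ-≤ l′ l′ l (subst (l′ ℕ.+ l′ ≤_) (ℕ.+-comm l l′) (m+m≤l+l′ l′≤v/2)))
    where
      m+m≤l+l′ : ∀ {m} → m ≤ v / 2 → m ℕ.+ m ≤ l ℕ.+ l′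
      m+m≤l+l′ m≤v/2 = subst (_ ≤_) (sym l+l′≡v) (m≤o/2⇒n≤o/2⇒m+n≤o m≤v/2 m≤v/2)

  fold : ℕ → ℕ
  fold d = d ⊓ (v ∸ d)

  +[v∸d]≡ᵥ-d : d ≤ v → + (v ∸ d) ≡ᵥ - + d
  +[v∸d]≡ᵥ-d {d} d≤v = begin
    + (v ∸ d)      ≡⟨ trans (sym (ℤ.⊖-≥ d≤v)) (sym (ℤ.m-n≡m⊖n v d)) ⟩
    + v - + d      ≈⟨ -‐cong v≡ᵥ0 (≡ᵥ-refl {+ d}) ⟩
    0ℤ - + d       ≡⟨ ℤ.+-identityˡ (- + d) ⟩
    - + d          ∎
    where open ≡ᵥ-Reasoning

  fold-≡± : d ≤ v → + fold d ≡± + d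
  fold-≡± {d} d≤v with ℕ.≤-total d (v ∸ d)
  ... | inj₁ d≤v∸d = inj₁ (≡ᵥ-reflexive (cong +_ (ℕ.m≤n⇒m⊓n≡m d≤v∸d)))
  ... | inj₂ v∸d≤d = inj₂ (≡ᵥ-trans (≡ᵥ-reflexive (cong +_ (ℕ.m≥n⇒m⊓n≡n v∸d≤d))) (+[v∸d]≡ᵥ-d d≤v))

  fold≤v/2 : d ≤ v → fold d ≤ v / 2
  fold≤v/2 {d} d≤v = m+m≤n⇒m≤n/2 (begin
    fold d ℕ.+ fold d  ≤⟨ ℕ.+-mono-≤ (ℕ.m⊓n≤m d (v ∸ d)) (ℕ.m⊓n≤n d (v ∸ d)) ⟩
    d ℕ.+ (v ∸ d)      ≡⟨ ℕ.m+[n∸m]≡n d≤v ⟩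
    v                  ∎)
    where open ℕ.≤-Reasoning

  ‖_‖ : ℤ → ℕ
  ‖ i ‖ = fold (i %ℕ v)

  ‖i‖≡±i : ∀ i → + ‖ i ‖ ≡± i
  ‖i‖≡±i i = ≡±-trans (fold-≡± (ℕ.<⇒≤ (n%ℕd<d i v))) (inj₁ (%ℕ-≡ᵥ i))

  ‖i‖≤v/2 : ∀ i → ‖ i ‖ ≤ v / 2
  ‖i‖≤v/2 i = fold≤v/2 (ℕ.<⇒≤ (n%ℕd<d i v))

  ‖‖-unique : l ≤ v / 2 → + l ≡± i → ‖ i ‖ ≡ l
  ‖‖-unique {i = i} l≤v/2 l≡±i = ≡±⇒≡ (‖i‖≤v/2 i) l≤v/2 (≡±-trans (‖i‖≡±i i) (≡±-sym l≡±i))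

  ‖‖-cong : i ≡± j → ‖ i ‖ ≡ ‖ j ‖
  ‖‖-cong {i} {j} i≡±j = ‖‖-unique (‖i‖≤v/2 j) (≡±-trans (‖i‖≡±i j) (≡±-sym i≡±j))

  edgeLen≡‖a-b‖ : a < v → b < v → edgeLen v a b ≡ ‖ + a - + b ‖
  edgeLen≡‖a-b‖ {a} {b} a<v b<v =
    sym (‖‖-unique (fold≤v/2 ∣a-b∣≤v) (≡±-trans (fold-≡± ∣a-b∣≤v) ∣a-b∣≡±a-b))
    where
      ∣a-b∣≤v : ℕ.∣ a - b ∣ ≤ v
      ∣a-b∣≤v = ℕ.≤-trans (ℕ.∣m-n∣≤m⊔n a b) (ℕ.⊔-lub (ℕ.<⇒≤ a<v) (ℕ.<⇒≤ b<v))
      ∣a-b∣≡±a-b : + ℕ.∣ a - b ∣ ≡± + a - + b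
      ∣a-b∣≡±a-b = subst (λ n → + n ≡± + a - + b) (∣+m-+n∣≡∣m-n∣ a b) (+∣i∣≡±i (+ a - + b))

  *-congʳ : ∀ k → i ≡ᵥ j → i * k ≡ᵥ j * k
  *-congʳ {i} {j} k i≡j = begin
    i * k   ≡⟨ ℤ.*-comm i k ⟩
    k * i   ≈⟨ *-congˡ k i≡j ⟩
    k * j   ≡⟨ ℤ.*-comm k j ⟩
    j * k   ∎
    where open ≡ᵥ-Reasoning

  record _IsInverseOf_ (j k : ℤ) : Set where
    constructor mkInverse
    field j*k≡1 : j * k ≡ᵥ 1ℤ

  IsInverseOf-sym : j IsInverseOf k → k IsInverseOf j
  IsInverseOf-sym {j} {k} (mkInverse j*k≡1) = mkInverse (≡ᵥ-trans (≡ᵥ-reflexive (ℤ.*-comm k j)) j*k≡1)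

  *-inverseˡ : j IsInverseOf k → ∀ i → j * (k * i) ≡ᵥ i
  *-inverseˡ {j} {k} (mkInverse j*k≡1) i = begin
    j * (k * i)   ≡⟨ ℤ.*-assoc j k i ⟨
    j * k * i     ≈⟨ *-congʳ i j*k≡1 ⟩
    1ℤ * i        ≡⟨ ℤ.*-identityˡ i ⟩
    i             ∎
    where open ≡ᵥ-Reasoning

  ∣-resp-≡ᵥ : + d ∣ + v → i ≡ᵥ j → + d ∣ i → + d ∣ j
  ∣-resp-≡ᵥ {i = i} {j} d∣v (mk≡ᵥ v∣i-j) d∣i =
    subst (_ ∣_) (identity i j) (∣m∣n⇒∣m-n d∣i (∣-trans d∣v v∣i-j))
    where identity : ∀ i j → i - (i - j) ≡ j
          identity = solve-∀

  ∣-resp-≡± : + d ∣ + v → i ≡± j → + d ∣ i → + d ∣ j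
  ∣-resp-≡± d∣v (inj₁ i≡j) d∣i = ∣-resp-≡ᵥ d∣v i≡j d∣i
  ∣-resp-≡± {j = j} d∣v (inj₂ i≡-j) d∣i =
    subst (_ ∣_) (ℤ.neg-involutive j) (∣m⇒∣-m (∣-resp-≡ᵥ d∣v i≡-j d∣i))

  scale : ℤ → ℕ → ℕ
  scale k a = (k * + a) %ℕ v

  scale<v : ∀ k a → scale k a < v
  scale<v k a = n%ℕd<d (k * + a) v

  scale-inverse : j IsInverseOf k → a < v → scale j (scale k a) ≡ a
  scale-inverse {j} {k} {a} inv a<v = ≡ᵥ⇒≡ (scale<v j _) a<v (begin
    + scale j (scale k a)   ≈⟨ %ℕ-≡ᵥ (j * + scale k a) ⟩
    j * + scale k a         ≈⟨ *-congˡ j (%ℕ-≡ᵥ (k * + a)) ⟩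
    j * (k * + a)           ≈⟨ *-inverseˡ inv (+ a) ⟩
    + a                     ∎)
    where open ≡ᵥ-Reasoning

  scaleLength : ℤ → ℕ → ℕ
  scaleLength k l = ‖ k * + l ‖

  edgeLen-scale : ∀ k → a < v → b < v →
                  edgeLen v (scale k a) (scale k b) ≡ scaleLength k (edgeLen v a b)
  edgeLen-scale {a} {b} k a<v b<v = begin
    edgeLen v (scale k a) (scale k b)   ≡⟨ edgeLen≡‖a-b‖ (scale<v k a) (scale<v k b) ⟩
    ‖ + scale k a - + scale k b ‖       ≡⟨ ‖‖-cong (inj₁ (-‐cong (%ℕ-≡ᵥ (k * + a)) (%ℕ-≡ᵥ (k * + b)))) ⟩
    ‖ k * + a - k * + b ‖               ≡⟨ cong ‖_‖ (identity k (+ a) (+ b)) ⟩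
    ‖ k * (+ a - + b) ‖                 ≡⟨ ‖‖-cong (*-congˡ-≡± k (≡±-sym (‖i‖≡±i (+ a - + b)))) ⟩
    ‖ k * + ‖ + a - + b ‖ ‖             ≡⟨ cong (scaleLength k) (edgeLen≡‖a-b‖ a<v b<v) ⟨
    scaleLength k (edgeLen v a b)       ∎
    where open ≡-Reasoning
          identity : ∀ k i j → k * i - k * j ≡ k * (i - j)
          identity = solve-∀

  scaleLength-≡± : j IsInverseOf k → ∀ l → j * + scaleLength k l ≡± + l
  scaleLength-≡± {j} {k} inv l =
    ≡±-trans (*-congˡ-≡± j (‖i‖≡±i (k * + l))) (inj₁ (*-inverseˡ inv (+ l)))

  scaleLength-inverse : j IsInverseOf k → l ≤ v / 2 → scaleLength j (scaleLength k l) ≡ l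
  scaleLength-inverse {k = k} inv l≤v/2 = ‖‖-unique l≤v/2 (≡±-sym (scaleLength-≡± inv _))

  scaleLength-injective : j IsInverseOf k → l ≤ v / 2 → l′ ≤ v / 2 →
                          scaleLength k l ≡ scaleLength k l′ → l ≡ l′
  scaleLength-injective {j} {k} {l} {l′} inv l≤v/2 l′≤v/2 eq = begin
    l                                ≡⟨ scaleLength-inverse inv l≤v/2 ⟨
    scaleLength j (scaleLength k l)  ≡⟨ cong (scaleLength j) eq ⟩
    scaleLength j (scaleLength k l′) ≡⟨ scaleLength-inverse inv l′≤v/2 ⟩
    l′                               ∎
    where open ≡-Reasoning

  scaleLength-zero : ∀ k → scaleLength k 0 ≡ 0
  scaleLength-zero k = ‖‖-unique z≤n (inj₁ (≡ᵥ-reflexive (sym (ℤ.*-zeroʳ k))))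

  scaleLength-coprime : j IsInverseOf k → Coprime v l → Coprime v (scaleLength k l)
  scaleLength-coprime {j} {k} {l} inv coprime {d} (d∣v , d∣kl) = coprime (d∣v , ∣⇒∣ᵤ d∣l)
    where
      d∣l : + d ∣ + l
      d∣l = ∣-resp-≡± (∣ᵤ⇒∣ d∣v) (scaleLength-≡± inv l)
                      (∣n⇒∣m*n j (∣ᵤ⇒∣ {+ d} {+ scaleLength k l} d∣kl))

  scaleLength-positive : j IsInverseOf k → 1 ≤ l → l ≤ v / 2 → 1 ≤ scaleLength k l
  scaleLength-positive {j} {k} {l} inv 1≤l l≤v/2 = ℕ.n≢0⇒n>0 λ σl≡0 →
    ℕ.n>0⇒n≢0 1≤l (scaleLength-injective inv l≤v/2 z≤n (trans σl≡0 (sym (scaleLength-zero k))))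

  map-scale-upTo : j IsInverseOf k → map (scale k) (upTo v) ↭ upTo v
  map-scale-upTo {j} {k} inv =
    map-upTo-↭ (λ _ → scale<v k _) (λ _ → scale<v j _)
               (scale-inverse inv) (scale-inverse (IsInverseOf-sym inv))

  pathLengths-scale : ∀ k {p} → All (_< v) p →
                      pathLengths v (map (scale k) p) ≡ map (scaleLength k) (pathLengths v p)
  pathLengths-scale k []                 = refl
  pathLengths-scale k (_ ∷ [])           = refl
  pathLengths-scale k (a<v ∷ b<v ∷ p<v) =
    cong₂ _∷_ (edgeLen-scale k a<v b<v) (pathLengths-scale k (b<v ∷ p<v))

  Realizable-scale : j IsInverseOf k → Realizable v L → Realizable v (map (scaleLength k) L)
  Realizable-scale {k = k} inv (p , p↭upTo , lengths↭L) =
      map (scale k) p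
    , ↭-trans (↭.map⁺ (scale k) p↭upTo) (map-scale-upTo inv)
    , ↭-trans (↭-reflexive (pathLengths-scale k p<v)) (↭.map⁺ (scaleLength k) lengths↭L)
    where p<v = All-resp-↭ (↭-sym p↭upTo) (All.tabulate ∈-upTo⁻)

  StronglyAdmissible-scale : j IsInverseOf k → StronglyAdmissible v L →
                             StronglyAdmissible v (map (scaleLength k) L)
  StronglyAdmissible-scale {j} {k} {L} inv (|L|≡v∸1 , bounded , coprime) =
      trans (length-map (scaleLength k) L) |L|≡v∸1
    , All.map⁺ (All.map scaled-bounds bounded)
    , All.map⁺ (All.map (scaleLength-coprime inv) coprime)
    where
      scaled-bounds : ∀ {l} → 1 ≤ l × l ≤ v / 2 → 1 ≤ scaleLength k l × scaleLength k l ≤ v / 2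
      scaled-bounds {l} (1≤l , l≤v/2) = scaleLength-positive inv 1≤l l≤v/2 , ‖i‖≤v/2 (k * + l)

  coprime⇒inverse : ∀ {m} → Coprime v m → ∃[ k ] k IsInverseOf + m
  coprime⇒inverse {m} coprime with coprime-Bézout coprime
  ... | Bézout.+- x y 1+y*m≡x*v = - + y , mkInverse (mk≡ᵥ (divides (- + x) (begin
    - + y * + m - 1ℤ       ≡⟨ identity (+ y) (+ m) ⟩
    - (1ℤ + + y * + m)     ≡⟨ cong -_ (1+a*b≡c*d⇒ℤ y m x v 1+y*m≡x*v) ⟩
    - (+ x * + v)          ≡⟨ ℤ.neg-distribˡ-* (+ x) (+ v) ⟩
    - + x * + v            ∎)))
    where open ≡-Reasoning
          identity : ∀ y m → - y * m - 1ℤ ≡ - (1ℤ + y * m)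
          identity = solve-∀
  ... | Bézout.-+ x y 1+x*v≡y*m = + y , mkInverse (mk≡ᵥ (divides (+ x) (begin
    + y * + m - 1ℤ          ≡⟨ cong (_- 1ℤ) (1+a*b≡c*d⇒ℤ x v y m 1+x*v≡y*m) ⟨
    1ℤ + + x * + v - 1ℤ     ≡⟨ identity (+ x * + v) ⟩
    + x * + v               ∎)))
    where open ≡-Reasoning
          identity : ∀ i → 1ℤ + i - 1ℤ ≡ i
          identity = solve-∀

blocks : ℕ → ℕ → ℕ → ℕ → ℕ → ℕ → List ℕ
blocks n₁ s₁ n₂ s₂ n₃ s₃ = replicate n₁ s₁ ++ replicate n₂ s₂ ++ replicate n₃ s₃

blocks-rotate : ∀ n₁ s₁ n₂ s₂ n₃ s₃ → blocks n₁ s₁ n₂ s₂ n₃ s₃ ↭ blocks n₂ s₂ n₃ s₃ n₁ s₁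
blocks-rotate n₁ s₁ n₂ s₂ n₃ s₃ =
  ↭-trans (++-comm (replicate n₁ s₁) _) (↭-reflexive (++-assoc (replicate n₂ s₂) _ _))

blocks-swap : ∀ n₁ s₁ n₂ s₂ n₃ s₃ → blocks n₁ s₁ n₂ s₂ n₃ s₃ ↭ blocks n₁ s₁ n₃ s₃ n₂ s₂
blocks-swap n₁ s₁ n₂ s₂ n₃ s₃ = ++⁺ˡ (replicate n₁ s₁) (++-comm (replicate n₂ s₂) _)

map-blocks : ∀ (f : ℕ → ℕ) n₁ s₁ n₂ s₂ n₃ s₃ →
             map f (blocks n₁ s₁ n₂ s₂ n₃ s₃) ≡ blocks n₁ (f s₁) n₂ (f s₂) n₃ (f s₃)
map-blocks f n₁ s₁ n₂ s₂ n₃ s₃ = begin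
  map f (blocks n₁ s₁ n₂ s₂ n₃ s₃)
    ≡⟨ map-++ f (replicate n₁ s₁) _ ⟩
  map f (replicate n₁ s₁) ++ map f (replicate n₂ s₂ ++ replicate n₃ s₃)
    ≡⟨ cong₂ _++_ (map-replicate f n₁ s₁) (map-++ f (replicate n₂ s₂) _) ⟩
  replicate n₁ (f s₁) ++ map f (replicate n₂ s₂) ++ map f (replicate n₃ s₃)
    ≡⟨ cong₂ (λ xs ys → replicate n₁ (f s₁) ++ xs ++ ys)
             (map-replicate f n₂ s₂) (map-replicate f n₃ s₃) ⟩
  blocks n₁ (f s₁) n₂ (f s₂) n₃ (f s₃)
    ∎
  where open ≡-Reasoning

∈-replicate : ∀ {n} {x : ℕ} → 1 ≤ n → x ∈ replicate n x
∈-replicate {suc _} _ = here refl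

∈-blocks⇒1≤n : ∀ {n₁ s₁ n₂ s₂ n₃ s₃} →
               s₁ ∈ blocks n₁ s₁ n₂ s₂ n₃ s₃ → s₁ ≢ s₂ → s₁ ≢ s₃ → 1 ≤ n₁
∈-blocks⇒1≤n {n₁ = suc _} _ _ _ = s≤s z≤n
∈-blocks⇒1≤n {n₁ = zero} {n₂ = n₂} {n₃ = n₃} s₁∈ s₁≢s₂ s₁≢s₃ =
  contradiction s₁∈ (All¬⇒¬Any (All.++⁺ (All.replicate⁺ n₂ s₁≢s₂) (All.replicate⁺ n₃ s₁≢s₃)))

↭-blocks : ∀ {s₁ s₂ s₃ L} → All (_∈ s₁ ∷ s₂ ∷ s₃ ∷ []) L →
           ∃[ n₁ ] ∃[ n₂ ] ∃[ n₃ ] L ↭ blocks n₁ s₁ n₂ s₂ n₃ s₃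
↭-blocks [] = 0 , 0 , 0 , ↭-refl
↭-blocks {s₁} {s₂} {s₃} {z ∷ L} (z∈ ∷ L⊆) with n₁ , n₂ , n₃ , L↭ ← ↭-blocks L⊆ | z∈
... | here refl = suc n₁ , n₂ , n₃ , prep z L↭
... | there (here refl) = n₁ , suc n₂ , n₃ ,
  ↭-trans (prep z L↭) (↭-sym (shift z (replicate n₁ s₁) _))
... | there (there (here refl)) = n₁ , n₂ , suc n₃ ,
  ↭-trans (prep z L↭) (↭-sym (↭-trans (++⁺ˡ (replicate n₁ s₁) (shift z (replicate n₂ s₂) _))
                                      (shift z (replicate n₁ s₁) _)))

record ThreeBlocks (L : List ℕ) : Set where
  field
    n₁ s₁ n₂ s₂ n₃ s₃ : ℕ
    1≤n₁ : 1 ≤ n₁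
    1≤n₂ : 1 ≤ n₂
    1≤n₃ : 1 ≤ n₃
    s₁≢s₂ : s₁ ≢ s₂
    s₁≢s₃ : s₁ ≢ s₃
    s₂≢s₃ : s₂ ≢ s₃
    L↭blocks : L ↭ blocks n₁ s₁ n₂ s₂ n₃ s₃

rotate : ThreeBlocks L → ThreeBlocks L
rotate B = record
  { n₁ = n₂ ; s₁ = s₂ ; n₂ = n₃ ; s₂ = s₃ ; n₃ = n₁ ; s₃ = s₁
  ; 1≤n₁ = 1≤n₂ ; 1≤n₂ = 1≤n₃ ; 1≤n₃ = 1≤n₁
  ; s₁≢s₂ = s₂≢s₃ ; s₁≢s₃ = ≢-sym s₁≢s₂ ; s₂≢s₃ = ≢-sym s₁≢s₃
  ; L↭blocks = ↭-trans L↭blocks (blocks-rotate n₁ s₁ n₂ s₂ n₃ s₃)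
  }
  where open ThreeBlocks B

support⇒ThreeBlocks : ∀ ss → Unique ss → (∀ {z} → z ∈ L → z ∈ ss) → (∀ {z} → z ∈ ss → z ∈ L) →
                      length ss ≡ 3 → ThreeBlocks L
support⇒ThreeBlocks {L} (s₁ ∷ s₂ ∷ s₃ ∷ []) ((s₁≢s₂ ∷ s₁≢s₃ ∷ []) ∷ (s₂≢s₃ ∷ []) ∷ _) L⊆ ⊆L _
  with n₁ , n₂ , n₃ , L↭ ← ↭-blocks (All.tabulate L⊆) = record
  { n₁ = n₁ ; s₁ = s₁ ; n₂ = n₂ ; s₂ = s₂ ; n₃ = n₃ ; s₃ = s₃
  ; 1≤n₁ = ∈-blocks⇒1≤n {n₂ = n₂} {n₃ = n₃} (∈-resp-↭ L↭ (⊆L (here refl)))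
                        s₁≢s₂ s₁≢s₃
  ; 1≤n₂ = ∈-blocks⇒1≤n {n₂ = n₃} {n₃ = n₁} (∈-resp-↭ L↭′ (⊆L (there (here refl))))
                        s₂≢s₃ (≢-sym s₁≢s₂)
  ; 1≤n₃ = ∈-blocks⇒1≤n {n₂ = n₁} {n₃ = n₂} (∈-resp-↭ L↭″ (⊆L (there (there (here refl)))))
                        (≢-sym s₁≢s₃) (≢-sym s₂≢s₃)
  ; s₁≢s₂ = s₁≢s₂ ; s₁≢s₃ = s₁≢s₃ ; s₂≢s₃ = s₂≢s₃
  ; L↭blocks = L↭
  }
  where
    L↭′ : L ↭ blocks n₂ s₂ n₃ s₃ n₁ s₁
    L↭′ = ↭-trans L↭ (blocks-rotate n₁ s₁ n₂ s₂ n₃ s₃)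
    L↭″ : L ↭ blocks n₃ s₃ n₁ s₁ n₂ s₂
    L↭″ = ↭-trans L↭′ (blocks-rotate n₂ s₂ n₃ s₃ n₁ s₁)

supp⇒ThreeBlocks : ∀ L → length (supp L) ≡ 3 → ThreeBlocks L
supp⇒ThreeBlocks L =
  support⇒ThreeBlocks (supp L) (deduplicate-! L) (∈-deduplicate⁺ _≟_) (∈-deduplicate⁻ _≟_ L)

FirstLargest : ThreeBlocks L → Set
FirstLargest B = n₂ ⊔ n₃ ≤ n₁
  where open ThreeBlocks B

largest-first : ThreeBlocks L → ∃[ B ] FirstLargest B
largest-first B with ℕ.≤-total n₂ n₁ | ℕ.≤-total n₃ n₁ | ℕ.≤-total n₃ n₂
  where open ThreeBlocks B
... | inj₁ n₂≤n₁ | inj₁ n₃≤n₁ | _         = B , ℕ.⊔-lub n₂≤n₁ n₃≤n₁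
... | inj₁ n₂≤n₁ | inj₂ _     | inj₁ n₃≤n₂ = B , ℕ.⊔-lub n₂≤n₁ (ℕ.≤-trans n₃≤n₂ n₂≤n₁)
... | inj₂ n₁≤n₂ | _          | inj₁ n₃≤n₂ = rotate B , ℕ.⊔-lub n₃≤n₂ n₁≤n₂
... | inj₂ n₁≤n₂ | inj₁ n₃≤n₁ | inj₂ n₂≤n₃ = B , ℕ.⊔-lub (ℕ.≤-trans n₂≤n₃ n₃≤n₁) n₃≤n₁
... | _          | inj₂ n₁≤n₃ | inj₂ n₂≤n₃ = rotate (rotate B) , ℕ.⊔-lub n₁≤n₃ n₂≤n₃

OneDominantRealizable : Set
OneDominantRealizable = (v a b c x y : ℕ) → 1 < x → x < y → 1 ≤ a → 1 ≤ b → 1 ≤ c → b ⊔ c ≤ a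
                        → StronglyAdmissible v (ms3 a x b y c) → Realizable v (ms3 a x b y c)

Realizable-resp-↭ : ∀ {v L L′} → L ↭ L′ → Realizable v L → Realizable v L′
Realizable-resp-↭ L↭L′ (p , p↭upTo , lengths↭L) = p , p↭upTo , ↭-trans lengths↭L L↭L′

StronglyAdmissible-resp-↭ : ∀ {v L L′} → L ↭ L′ → StronglyAdmissible v L → StronglyAdmissible v L′
StronglyAdmissible-resp-↭ L↭L′ (|L|≡v∸1 , bounded , coprime) =
  trans (sym (↭-length L↭L′)) |L|≡v∸1 , All-resp-↭ L↭L′ bounded , All-resp-↭ L↭L′ coprime

realizable-largest-first : OneDominantRealizable → ∀ {v} .{{_ : NonZero v}} {L} (B : ThreeBlocks L) →
                           FirstLargest B → StronglyAdmissible v L → Realizable v L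
realizable-largest-first realizable-ms3 {v} {L} B n₂⊔n₃≤n₁ saL =
  Realizable-resp-↭ (↭-sym L↭blocks)
    (subst (Realizable v) scale-back (Realizable-scale u-inv realizable-σM))
  where
    open ThreeBlocks B
    open Modulo v

    M : List ℕ
    M = blocks n₁ s₁ n₂ s₂ n₃ s₃
    s₁∈M : s₁ ∈ M
    s₁∈M = ∈-++⁺ˡ (∈-replicate 1≤n₁)
    s₂∈M : s₂ ∈ M
    s₂∈M = ∈-++⁺ʳ (replicate n₁ s₁) (∈-++⁺ˡ (∈-replicate 1≤n₂))
    s₃∈M : s₃ ∈ M
    s₃∈M = ∈-++⁺ʳ (replicate n₁ s₁) (∈-++⁺ʳ (replicate n₂ s₂) (∈-replicate 1≤n₃))

    saM : StronglyAdmissible v M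
    saM = StronglyAdmissible-resp-↭ L↭blocks saL
    bounds : ∀ {s} → s ∈ M → 1 ≤ s × s ≤ v / 2
    bounds = All.lookup (proj₁ (proj₂ saM))

    unit : ∃[ u ] u IsInverseOf + s₁
    unit = coprime⇒inverse (All.lookup (proj₂ (proj₂ saM)) s₁∈M)
    u : ℤ
    u = proj₁ unit
    u-inv : u IsInverseOf + s₁
    u-inv = proj₂ unit
    s₁-inv : + s₁ IsInverseOf u
    s₁-inv = IsInverseOf-sym u-inv
    σ : ℕ → ℕ
    σ = scaleLength u

    σ-injective : ∀ {s s′} → s ∈ M → s′ ∈ M → σ s ≡ σ s′ → s ≡ s′
    σ-injective s∈M s′∈M =
      scaleLength-injective s₁-inv (proj₂ (bounds s∈M)) (proj₂ (bounds s′∈M))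

    σs₁≡1 : σ s₁ ≡ 1
    σs₁≡1 = ‖‖-unique (ℕ.≤-trans (proj₁ (bounds s₁∈M)) (proj₂ (bounds s₁∈M)))
                      (inj₁ (≡ᵥ-sym (_IsInverseOf_.j*k≡1 u-inv)))

    1<σ : ∀ {s} → s ∈ M → s₁ ≢ s → 1 < σ s
    1<σ s∈M s₁≢s = ℕ.≤∧≢⇒<
      (scaleLength-positive s₁-inv (proj₁ (bounds s∈M)) (proj₂ (bounds s∈M)))
      (λ 1≡σs → s₁≢s (σ-injective s₁∈M s∈M (trans σs₁≡1 1≡σs)))

    σM≡ms3 : map σ M ≡ ms3 n₁ (σ s₂) n₂ (σ s₃) n₃
    σM≡ms3 = trans (map-blocks σ n₁ s₁ n₂ s₂ n₃ s₃)
                   (cong (λ t → blocks n₁ t n₂ (σ s₂) n₃ (σ s₃)) σs₁≡1)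

    sa-ms3 : StronglyAdmissible v (ms3 n₁ (σ s₂) n₂ (σ s₃) n₃)
    sa-ms3 = subst (StronglyAdmissible v) σM≡ms3 (StronglyAdmissible-scale s₁-inv saM)

    realizable-σM : Realizable v (map σ M)
    realizable-σM with ℕ.<-cmp (σ s₂) (σ s₃)
    ... | tri< x<y _ _ = subst (Realizable v) (sym σM≡ms3)
      (realizable-ms3 v n₁ n₂ n₃ (σ s₂) (σ s₃) (1<σ s₂∈M s₁≢s₂) x<y 1≤n₁ 1≤n₂ 1≤n₃ n₂⊔n₃≤n₁ sa-ms3)
    ... | tri≈ _ x≡y _ = contradiction (σ-injective s₂∈M s₃∈M x≡y) s₂≢s₃
    ... | tri> _ _ y<x = subst (Realizable v) (sym σM≡ms3)
      (Realizable-resp-↭ (blocks-swap n₁ 1 n₃ (σ s₃) n₂ (σ s₂))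
        (realizable-ms3 v n₁ n₃ n₂ (σ s₃) (σ s₂) (1<σ s₃∈M s₁≢s₃) y<x 1≤n₁ 1≤n₃ 1≤n₂
          (subst (_≤ n₁) (ℕ.⊔-comm n₂ n₃) n₂⊔n₃≤n₁)
          (StronglyAdmissible-resp-↭ (blocks-swap n₁ 1 n₂ (σ s₂) n₃ (σ s₃)) sa-ms3)))

    scale-back : map (scaleLength (+ s₁)) (map σ M) ≡ M
    scale-back = trans (sym (map-∘ M))
      (map-id-local (All.map (λ (_ , s≤v/2) → scaleLength-inverse s₁-inv s≤v/2) (proj₁ (proj₂ saM))))

lemma1p7 : ((v a b c x y : ℕ) → 1 < x → x < y → 1 ≤ a → 1 ≤ b → 1 ≤ c → b ⊔ c ≤ a
             → StronglyAdmissible v (ms3 a x b y c) → Realizable v (ms3 a x b y c))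
           → (v : ℕ) (L : List ℕ) → StronglyAdmissible v L → length (supp L) ≡ 3
           → Realizable v L
lemma1p7 _ zero [] _ ()
lemma1p7 _ zero (_ ∷ _) (() , _) _
lemma1p7 realizable-ms3 (suc _) L saL |supp|≡3
  with B , n₂⊔n₃≤n₁ ← largest-first (supp⇒ThreeBlocks L |supp|≡3) =
  realizable-largest-first realizable-ms3 B n₂⊔n₃≤n₁ saL
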